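{- Let $\mathcal{F}$ be a hereditary family of graphs such that every graph in $\mathcal{F}$ has the $(t,k)$-homogeneous property. Let $G$ be a graph on $n$ vertices such that, with probability at least $1/2$, a uniformly random subset of $2t$ vertices of $G$ contains a set of $t$ vertices inducing a graph in $\mathcal{F}$. Then $G$ contains at least $\frac12\left(\frac{n}{2t}\right)^k$ homogeneous sets of order $k$.
   Context: A family of graphs is hereditary if closed under induced subgraphs. A homogeneous set is a clique or an independent set. A graph has the $(t,k)$-homogeneous property if every subset of $t$ of its vertices contains a homogeneous set of order $k$. -}

module Defs where

open import Level using (Level; suc; _⊔_)
open import Data.Nat using (ℕ)
open import Data.Bool using (Bool; true; false)
open import Data.Fin using (Fin)
open import Data.Fin.Subset using (Subset; _∈_; _⊆_; ∣_∣)
open import Data.Product using (Σ; _×_; ∃; ∃-syntax)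
open import Data.Sum using (_⊎_)
open import Relation.Binary.PropositionalEquality using (_≡_; _≢_)
open import Function.Definitions using (Injective)

record Graph (n : ℕ) : Set where
  field
    adj    : Fin n → Fin n → Bool
    sym    : ∀ i j → adj i j ≡ adj j i
    irrefl : ∀ i → adj i i ≡ false
open Graph public

induced : ∀ {m n} → Graph n → (f : Fin m → Fin n) → Graph m
induced G f = record
  { adj    = λ i j → adj G (f i) (f j)
  ; sym    = λ i j → sym G (f i) (f j)
  ; irrefl = λ i → irrefl G (f i) }

Family : (ℓ : Level) → Set (suc ℓ)
Family ℓ = ∀ {m} → Graph m → Set ℓ

Hereditary : ∀ {ℓ} → Family ℓ → Set ℓ
Hereditary F = ∀ {m n} (G : Graph n) (f : Fin m → Fin n) →
  Injective _≡_ _≡_ f → F G → F (induced G f)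

IsClique : ∀ {n} → Graph n → Subset n → Set
IsClique G S = ∀ i j → i ∈ S → j ∈ S → i ≢ j → adj G i j ≡ true

IsIndependent : ∀ {n} → Graph n → Subset n → Set
IsIndependent G S = ∀ i j → i ∈ S → j ∈ S → adj G i j ≡ false

Homogeneous : ∀ {n} → Graph n → Subset n → Set
Homogeneous G S = IsClique G S ⊎ IsIndependent G S

HomProp : ℕ → ℕ → ∀ {n} → Graph n → Set
HomProp t k G = ∀ T → ∣ T ∣ ≡ t → ∃[ S ] (S ⊆ T × ∣ S ∣ ≡ k × Homogeneous G S)

-- U contains a set T of t vertices inducing a graph in F
-- (the induced graph on T, with T enumerated by an injective f onto T).
ContainsInF : ∀ {ℓ} → Family ℓ → ℕ → ∀ {n} → Graph n → Subset n → Set ℓ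
ContainsInF F t {n} G U =
  ∃[ T ] (T ⊆ U × ∣ T ∣ ≡ t ×
    Σ (Fin t → Fin n) λ f → Injective _≡_ _≡_ f × (∀ i → f i ∈ T) × F (induced G f))

{-# OPTIONS --safe #-}
-- Call a 2t-set good if t of its vertices induce a member of F. Every good set contains
-- a homogeneous k-set: the (t,k)-homogeneous property of that member yields one, which is
-- transported along the enumeration of its vertices. A fixed k-set lies in at most
-- C(n-k, 2t-k) sets of size 2t, so the h homogeneous k-sets cover at most h C(n-k, 2t-k)
-- good sets, while there are at least C(n, 2t)/2 of them. Finally
-- C(n, 2t)/C(n-k, 2t-k) = C(n, k)/C(2t, k) is at least (n/2t)^k.
module Submission where

open import Defs hiding (sym)
open import Data.Bool using (Bool; true; false)
import Data.Bool as Bool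
open import Data.Fin using (Fin; zero; suc)
import Data.Fin.Properties as Fin
open import Data.Fin.Subset using (Subset; _∈_; _∉_; _⊆_; ∣_∣; ⊥; ⊤; ⁅_⁆; _∪_; ∁)
open import Data.Fin.Subset.Properties
  using (∉⊥; ∣⊥∣≡0; ∣⊤∣≡n; ∣∁p∣≡n∸∣p∣; drop-∷-⊆; p⊆q⇒∣p∣≤∣q∣; _⊆?_; x∈p∪q⁻; x∈⁅y⁆⇒x≡y; ∪-identityˡ)
open import Data.List using (List; []; _∷_; length; filter)
import Data.List.Membership.Propositional as List
open import Data.List.Relation.Unary.All using (All; []; _∷_)
import Data.List.Relation.Unary.All as All
open import Data.List.Relation.Unary.All.Properties using (all-filter; ¬Any⇒All¬)
import Data.List.Relation.Unary.All.Properties as Allₚ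
open import Data.List.Relation.Unary.Any using (here; there)
open import Data.List.Relation.Unary.AllPairs using ([]; _∷_)
open import Data.List.Relation.Unary.Unique.Propositional using (Unique)
import Data.List.Relation.Unary.Unique.Propositional.Properties as Uniqueₚ
open import Data.Nat using (ℕ; zero; suc; _+_; _*_; _^_; _∸_; _≤_; _<_; z≤n; s≤s; >-nonZero)
open import Data.Nat.Combinatorics using (_C_; nC1≡n; nCk+nC[k+1]≡[n+1]C[k+1])
open import Data.Nat.Properties
open import Data.Product using (_×_; _,_; ∃; ∃-syntax; proj₁)
open import Data.Sum using (inj₁; inj₂)
open import Data.Vec using (_∷_; []; here; there)
import Data.Vec.Properties as Vec
open import Function using (_∘_)
open import Function.Definitions using (Injective)
open import Relation.Binary.Definitions using (DecidableEquality)
open import Relation.Binary.PropositionalEquality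
  using (_≡_; refl; sym; trans; cong; cong₂; subst; subst₂; module ≡-Reasoning)
open import Relation.Nullary using (¬_; yes; no; contradiction; ¬?; _×-dec_)
open import Relation.Unary using (Decidable)
open import Algebra.Properties.CommutativeSemigroup *-commutativeSemigroup
  using (interchange; x∙yz≈y∙xz; x∙yz≈yx∙z; xy∙z≈y∙xz)

k≤n⇒nCk>0 : ∀ {n k} → k ≤ n → 0 < n C k
k≤n⇒nCk>0 z≤n = s≤s z≤n
k≤n⇒nCk>0 {suc n} {suc k} (s≤s k≤n) =
  subst (0 <_) (nCk+nC[k+1]≡[n+1]C[k+1] n k) (≤-trans (k≤n⇒nCk>0 k≤n) (m≤m+n _ _))

[1+k]*[1+n]C[1+k]≡[1+n]*nCk : ∀ n k → suc k * (suc n C suc k) ≡ suc n * (n C k)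
[1+k]*[1+n]C[1+k]≡[1+n]*nCk zero    zero    = refl
[1+k]*[1+n]C[1+k]≡[1+n]*nCk zero    (suc k) = *-zeroʳ (suc (suc k))
[1+k]*[1+n]C[1+k]≡[1+n]*nCk (suc n) zero    = trans (+-identityʳ _) (trans (nC1≡n (suc (suc n))) (sym (*-identityʳ _)))
[1+k]*[1+n]C[1+k]≡[1+n]*nCk (suc n) (suc k) = begin
  suc (suc k) * (suc (suc n) C suc (suc k))      ≡⟨ cong (suc (suc k) *_) (nCk+nC[k+1]≡[n+1]C[k+1] (suc n) (suc k)) ⟨
  suc (suc k) * (A + B)                           ≡⟨ *-distribˡ-+ (suc (suc k)) A B ⟩
  A + suc k * A + suc (suc k) * B                 ≡⟨ cong₂ (λ x y → A + x + y) ([1+k]*[1+n]C[1+k]≡[1+n]*nCk n k) ([1+k]*[1+n]C[1+k]≡[1+n]*nCk n (suc k)) ⟩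
  A + suc n * (n C k) + suc n * (n C suc k)       ≡⟨ +-assoc A _ _ ⟩
  A + (suc n * (n C k) + suc n * (n C suc k))     ≡⟨ cong (A +_) (*-distribˡ-+ (suc n) (n C k) (n C suc k)) ⟨
  A + suc n * (n C k + n C suc k)                 ≡⟨ cong (λ x → A + suc n * x) (nCk+nC[k+1]≡[n+1]C[k+1] n k) ⟩
  suc (suc n) * A                                 ∎
  where
  open ≡-Reasoning
  A = suc n C suc k
  B = suc n C suc (suc k)

[1+n]*m≤n*[1+m] : ∀ {m n} → m ≤ n → suc n * m ≤ n * suc m
[1+n]*m≤n*[1+m] {m} {n} m≤n = begin
  m + n * m  ≤⟨ +-monoˡ-≤ (n * m) m≤n ⟩
  n + n * m  ≡⟨ *-suc n m ⟨
  n * suc m  ∎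
  where open ≤-Reasoning

^-distrib-* : ∀ m n k → (m * n) ^ k ≡ m ^ k * n ^ k
^-distrib-* m n zero    = refl
^-distrib-* m n (suc k) = trans (cong (m * n *_) (^-distrib-* m n k)) (interchange m n (m ^ k) (n ^ k))

k≤m⇒m^k>0 : ∀ {m k} → k ≤ m → 0 < m ^ k
k≤m⇒m^k>0 {k = zero}        _ = s≤s z≤n
k≤m⇒m^k>0 {suc m} {suc k}   _ = m^n>0 (suc m) (suc k)

-- Induction on k: (n+1)/(m+1) ≤ n/m, and absorption takes C(n+1, m+1) down to C(n, m).
n^k*[n∸k]C[m∸k]≤m^k*nCm : ∀ k {m n} → k ≤ m → m ≤ n → n ^ k * ((n ∸ k) C (m ∸ k)) ≤ m ^ k * (n C m)
n^k*[n∸k]C[m∸k]≤m^k*nCm zero    _         _         = ≤-refl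
n^k*[n∸k]C[m∸k]≤m^k*nCm (suc k) {suc m} {suc n} (s≤s k≤m) (s≤s m≤n) = begin
  suc n ^ suc k * c                      ≡⟨ *-assoc (suc n) (suc n ^ k) c ⟩
  suc n * (suc n ^ k * c)                ≤⟨ *-monoʳ-≤ (suc n) shifted ⟩
  suc n * (suc m ^ k * (n C m))          ≡⟨ x∙yz≈y∙xz (suc n) (suc m ^ k) (n C m) ⟩
  suc m ^ k * (suc n * (n C m))          ≡⟨ cong (suc m ^ k *_) ([1+k]*[1+n]C[1+k]≡[1+n]*nCk n m) ⟨
  suc m ^ k * (suc m * (suc n C suc m))  ≡⟨ x∙yz≈yx∙z (suc m ^ k) (suc m) (suc n C suc m) ⟩
  suc m ^ suc k * (suc n C suc m)        ∎
  where
  open ≤-Reasoning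
  c = (n ∸ k) C (m ∸ k)
  shifted : suc n ^ k * c ≤ suc m ^ k * (n C m)
  shifted = *-cancelˡ-≤ (m ^ k) {{>-nonZero (k≤m⇒m^k>0 k≤m)}} (begin
    m ^ k * (suc n ^ k * c)      ≡⟨ x∙yz≈yx∙z (m ^ k) (suc n ^ k) c ⟩
    suc n ^ k * m ^ k * c        ≡⟨ cong (_* c) (^-distrib-* (suc n) m k) ⟨
    (suc n * m) ^ k * c          ≤⟨ *-monoˡ-≤ c (^-monoˡ-≤ k ([1+n]*m≤n*[1+m] m≤n)) ⟩
    (n * suc m) ^ k * c          ≡⟨ cong (_* c) (^-distrib-* n (suc m) k) ⟩
    n ^ k * suc m ^ k * c        ≡⟨ xy∙z≈y∙xz (n ^ k) (suc m ^ k) c ⟩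
    suc m ^ k * (n ^ k * c)      ≤⟨ *-monoʳ-≤ (suc m ^ k) (n^k*[n∸k]C[m∸k]≤m^k*nCm k k≤m m≤n) ⟩
    suc m ^ k * (m ^ k * (n C m)) ≡⟨ x∙yz≈y∙xz (suc m ^ k) (m ^ k) (n C m) ⟩
    m ^ k * (suc m ^ k * (n C m)) ∎)

n^k≤2*m^k*h : ∀ {k m n l h} → k ≤ m → m ≤ n →
  n C m ≤ 2 * l → l ≤ h * ((n ∸ k) C (m ∸ k)) → n ^ k ≤ 2 * m ^ k * h
n^k≤2*m^k*h {k} {m} {n} {l} {h} k≤m m≤n nCm≤2l l≤hc =
  *-cancelʳ-≤ (n ^ k) (2 * m ^ k * h) c {{>-nonZero (k≤n⇒nCk>0 (∸-monoˡ-≤ k m≤n))}} (begin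
    n ^ k * c              ≤⟨ n^k*[n∸k]C[m∸k]≤m^k*nCm k k≤m m≤n ⟩
    m ^ k * (n C m)        ≤⟨ *-monoʳ-≤ (m ^ k) nCm≤2l ⟩
    m ^ k * (2 * l)        ≤⟨ *-monoʳ-≤ (m ^ k) (*-monoʳ-≤ 2 l≤hc) ⟩
    m ^ k * (2 * (h * c))  ≡⟨ x∙yz≈yx∙z (m ^ k) 2 (h * c) ⟩
    2 * m ^ k * (h * c)    ≡⟨ *-assoc (2 * m ^ k) h c ⟨
    2 * m ^ k * h * c      ∎)
  where
  open ≤-Reasoning
  c = (n ∸ k) C (m ∸ k)

withHead : ∀ {n} → Bool → List (Subset (suc n)) → List (Subset n)
withHead b []              = []
withHead b ((x ∷ p) ∷ ps) with x Bool.≟ b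
... | yes _ = p ∷ withHead b ps
... | no  _ = withHead b ps

length-withHead : ∀ {n} (ps : List (Subset (suc n))) →
  length ps ≡ length (withHead true ps) + length (withHead false ps)
length-withHead []                 = refl
length-withHead ((true ∷ p) ∷ ps)  = cong suc (length-withHead ps)
length-withHead ((false ∷ p) ∷ ps) = trans (cong suc (length-withHead ps)) (sym (+-suc _ _))

length-withHead-≤ : ∀ {n a b} (ps : List (Subset (suc n))) →
  length (withHead true ps) ≤ a → length (withHead false ps) ≤ b → length ps ≤ a + b
length-withHead-≤ ps ≤a ≤b = subst (_≤ _) (sym (length-withHead ps)) (+-mono-≤ ≤a ≤b)

All-withHead : ∀ {n} {P : Subset (suc n) → Set} b {ps} → All P ps → All (λ p → P (b ∷ p)) (withHead b ps)
All-withHead b {[]}            []          = []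
All-withHead b {(x ∷ p) ∷ ps} (px ∷ pps) with x Bool.≟ b
... | yes refl = px ∷ All-withHead b pps
... | no  _    = All-withHead b pps

Unique-withHead : ∀ {n} b {ps : List (Subset (suc n))} → Unique ps → Unique (withHead b ps)
Unique-withHead b {[]}            []             = []
Unique-withHead b {(x ∷ p) ∷ ps} (p∉ps ∷ uniq) with x Bool.≟ b
... | yes refl = All.map (λ ne → ne ∘ cong (b ∷_)) (All-withHead b p∉ps) ∷ Unique-withHead b uniq
... | no  _    = Unique-withHead b uniq

All-impossible⇒length≤0 : ∀ {A : Set} {P : A → Set} {xs} → (∀ {x} → ¬ P x) → All P xs → length xs ≤ 0
All-impossible⇒length≤0 _  []       = z≤n
All-impossible⇒length≤0 ¬P (px ∷ _) = contradiction px ¬P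

ExtendsBy : ∀ {n} → Subset n → ℕ → Subset n → Set
ExtendsBy S j U = S ⊆ U × ∣ U ∣ ≡ ∣ S ∣ + j

ExtendsBy? : ∀ {n} (S : Subset n) j → Decidable (ExtendsBy S j)
ExtendsBy? S j U = (S ⊆? U) ×-dec (∣ U ∣ ≟ ∣ S ∣ + j)

ExtendsBy-drop : ∀ {n} s {S U : Subset n} {j} → ExtendsBy (s ∷ S) j (s ∷ U) → ExtendsBy S j U
ExtendsBy-drop true  (S⊆U , eq) = drop-∷-⊆ S⊆U , suc-injective eq
ExtendsBy-drop false (S⊆U , eq) = drop-∷-⊆ S⊆U , eq

ExtendsBy-dropNew : ∀ {n} {S U : Subset n} {j} → ExtendsBy (false ∷ S) (suc j) (true ∷ U) → ExtendsBy S j U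
ExtendsBy-dropNew (S⊆U , eq) = drop-∷-⊆ S⊆U , suc-injective (trans eq (+-suc _ _))

-- Split the list by whether vertex 0 lies in U; when 0 ∉ S this is Pascal's rule.
length-extensions≤ : ∀ {n} (S : Subset n) j {Us} → Unique Us → All (ExtendsBy S j) Us → length Us ≤ ∣ ∁ S ∣ C j
length-extensions≤ [] zero    {[]}          _                  _                 = z≤n
length-extensions≤ [] zero    {[] ∷ []}     _                  _                 = ≤-refl
length-extensions≤ [] zero    {[] ∷ [] ∷ _} ((≢[] ∷ _) ∷ _)    _                 = contradiction refl ≢[]
length-extensions≤ [] (suc j) {[]}          _                  _                 = z≤n
length-extensions≤ [] (suc j) {[] ∷ _}      _                  ((_ , ()) ∷ _)
length-extensions≤ (true ∷ S) j {Us} uniq ext =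
  subst (length Us ≤_) (+-identityʳ _) (length-withHead-≤ Us
    (length-extensions≤ S j (Unique-withHead true uniq) (All.map (ExtendsBy-drop true) (All-withHead true ext)))
    (All-impossible⇒length≤0 (λ (S⊆U , _) → contradiction (S⊆U here) λ ()) (All-withHead false ext)))
length-extensions≤ (false ∷ S) zero {Us} uniq ext =
  length-withHead-≤ Us
    (All-impossible⇒length≤0 too-large (All-withHead true ext))
    (length-extensions≤ S zero (Unique-withHead false uniq) (All.map (ExtendsBy-drop false) (All-withHead false ext)))
  where
  too-large : ∀ {U} → ¬ ExtendsBy (false ∷ S) zero (true ∷ U)
  too-large (S⊆U , eq) = 1+n≰n (≤-trans (s≤s (p⊆q⇒∣p∣≤∣q∣ (drop-∷-⊆ S⊆U))) (≤-reflexive (trans eq (+-identityʳ _))))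
length-extensions≤ (false ∷ S) (suc j) {Us} uniq ext =
  subst (length Us ≤_) (nCk+nC[k+1]≡[n+1]C[k+1] ∣ ∁ S ∣ j) (length-withHead-≤ Us
    (length-extensions≤ S j (Unique-withHead true uniq) (All.map ExtendsBy-dropNew (All-withHead true ext)))
    (length-extensions≤ S (suc j) (Unique-withHead false uniq) (All.map (ExtendsBy-drop false) (All-withHead false ext))))

length-filter+filter¬ : ∀ {A : Set} {P : A → Set} (P? : Decidable P) xs →
  length xs ≡ length (filter P? xs) + length (filter (¬? ∘ P?) xs)
length-filter+filter¬ P? []       = refl
length-filter+filter¬ P? (x ∷ xs) with P? x
... | yes _ = cong suc (length-filter+filter¬ P? xs)
... | no  _ = trans (cong suc (length-filter+filter¬ P? xs)) (sym (+-suc _ _))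

Covered : ∀ {A B : Set} → (A → B → Set) → List A → B → Set
Covered R as b = ∃ λ a → a List.∈ as × R a b

module _ {A B : Set} {R : A → B → Set} (R? : ∀ a → Decidable (R a)) where

  length-≤-cover : ∀ c as → All (λ a → ∀ {bs} → Unique bs → All (R a) bs → length bs ≤ c) as →
    ∀ {bs} → Unique bs → All (Covered R as) bs → length bs ≤ length as * c
  length-≤-cover c []       []              {[]}    _    _                  = z≤n
  length-≤-cover c []       []              {_ ∷ _} _    ((_ , () , _) ∷ _)
  length-≤-cover c (a ∷ as) (boundA ∷ bound) {bs}   uniq cov = begin
    length bs                                                   ≡⟨ length-filter+filter¬ (R? a) bs ⟩
    length (filter (R? a) bs) + length (filter (¬? ∘ R? a) bs)  ≤⟨ +-mono-≤ byA byRest ⟩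
    c + length as * c                                           ∎
    where
    open ≤-Reasoning
    byA : length (filter (R? a) bs) ≤ c
    byA = boundA (Uniqueₚ.filter⁺ (R? a) uniq) (all-filter (R? a) bs)
    coveredByRest : ∀ {b} → Covered R (a ∷ as) b × ¬ R a b → Covered R as b
    coveredByRest ((_ , here refl , r) , ¬r) = contradiction r ¬r
    coveredByRest ((a′ , there a′∈ , r) , _) = a′ , a′∈ , r
    byRest : length (filter (¬? ∘ R? a) bs) ≤ length as * c
    byRest = length-≤-cover c as bound (Uniqueₚ.filter⁺ (¬? ∘ R? a) uniq)
      (All.zipWith coveredByRest (Allₚ.filter⁺ (¬? ∘ R? a) cov , all-filter (¬? ∘ R? a) bs))

module _ {A B : Set} {P : A → Set} {R : A → B → Set} (_≟_ : DecidableEquality A) where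

  open import Data.List.Membership.DecPropositional _≟_ using (_∈?_)

  unique-witnesses : ∀ {bs} → All (λ b → ∃ λ a → P a × R a b) bs →
    ∃ λ as → Unique as × All P as × All (Covered R as) bs
  unique-witnesses [] = [] , [] , [] , []
  unique-witnesses ((a , pa , r) ∷ ws) with unique-witnesses ws
  ... | as , uniq , pas , cov with a ∈? as
  ...   | yes a∈ = as , uniq , pas , (a , a∈ , r) ∷ cov
  ...   | no  a∉ = a ∷ as , ¬Any⇒All¬ as a∉ ∷ uniq , pa ∷ pas ,
                   (a , here refl , r) ∷ All.map (λ (a′ , a′∈ , r′) → a′ , there a′∈ , r′) cov

∣⁅x⁆∪p∣≡1+∣p∣ : ∀ {n} {x : Fin n} {p : Subset n} → x ∉ p → ∣ ⁅ x ⁆ ∪ p ∣ ≡ suc ∣ p ∣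
∣⁅x⁆∪p∣≡1+∣p∣ {x = zero}  {true ∷ p}  x∉p = contradiction here x∉p
∣⁅x⁆∪p∣≡1+∣p∣ {x = zero}  {false ∷ p} _   = cong (suc ∘ ∣_∣) (∪-identityˡ p)
∣⁅x⁆∪p∣≡1+∣p∣ {x = suc x} {true ∷ p}  x∉p = cong suc (∣⁅x⁆∪p∣≡1+∣p∣ (x∉p ∘ there))
∣⁅x⁆∪p∣≡1+∣p∣ {x = suc x} {false ∷ p} x∉p = ∣⁅x⁆∪p∣≡1+∣p∣ (x∉p ∘ there)

image : ∀ {m n} → (Fin m → Fin n) → Subset m → Subset n
image f []          = ⊥
image f (false ∷ p) = image (f ∘ suc) p
image f (true ∷ p)  = ⁅ f zero ⁆ ∪ image (f ∘ suc) p

∈-image⁻ : ∀ {m n} (f : Fin m → Fin n) p {y} → y ∈ image f p → ∃ λ x → x ∈ p × f x ≡ y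
∈-image⁻ f []          y∈ = contradiction y∈ ∉⊥
∈-image⁻ f (false ∷ p) y∈ with ∈-image⁻ (f ∘ suc) p y∈
... | x , x∈p , refl = suc x , there x∈p , refl
∈-image⁻ f (true ∷ p)  y∈ with x∈p∪q⁻ ⁅ f zero ⁆ (image (f ∘ suc) p) y∈
... | inj₁ y∈⁅f0⁆ = zero , here , sym (x∈⁅y⁆⇒x≡y (f zero) y∈⁅f0⁆)
... | inj₂ y∈rest with ∈-image⁻ (f ∘ suc) p y∈rest
...   | x , x∈p , refl = suc x , there x∈p , refl

∣image∣ : ∀ {m n} {f : Fin m → Fin n} → Injective _≡_ _≡_ f → ∀ p → ∣ image f p ∣ ≡ ∣ p ∣
∣image∣ {n = n} _ []   = ∣⊥∣≡0 n
∣image∣ inj (false ∷ p) = ∣image∣ (Fin.suc-injective ∘ inj) p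
∣image∣ {f = f} inj (true ∷ p) = trans (∣⁅x⁆∪p∣≡1+∣p∣ f0∉) (cong suc (∣image∣ (Fin.suc-injective ∘ inj) p))
  where
  f0∉ : f zero ∉ image (f ∘ suc) p
  f0∉ f0∈ with ∈-image⁻ (f ∘ suc) p f0∈
  ... | _ , _ , eq with inj eq
  ... | ()

image-⊆ : ∀ {m n} {f : Fin m → Fin n} {U} → (∀ x → f x ∈ U) → ∀ p → image f p ⊆ U
image-⊆ {f = f} f∈U p y∈ with ∈-image⁻ f p y∈
... | x , _ , refl = f∈U x

image-homogeneous : ∀ {m n} (G : Graph n) (f : Fin m → Fin n) {p} →
  Homogeneous (induced G f) p → Homogeneous G (image f p)
image-homogeneous G f {p} (inj₁ clique) = inj₁ clique′
  where
  clique′ : IsClique G (image f p)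
  clique′ i j i∈ j∈ i≢j with ∈-image⁻ f p i∈ | ∈-image⁻ f p j∈
  ... | x , x∈ , refl | y , y∈ , refl = clique x y x∈ y∈ (i≢j ∘ cong f)
image-homogeneous G f {p} (inj₂ independent) = inj₂ independent′
  where
  independent′ : IsIndependent G (image f p)
  independent′ i j i∈ j∈ with ∈-image⁻ f p i∈ | ∈-image⁻ f p j∈
  ... | x , x∈ , refl | y , y∈ , refl = independent x y x∈ y∈

homogeneous⊆ : ∀ {ℓ} {F : Family ℓ} {t k n} → (∀ {m} (H : Graph m) → F H → HomProp t k H) →
  (G : Graph n) → ∀ {U} → ContainsInF F t G U → ∃ λ S → (∣ S ∣ ≡ k × Homogeneous G S) × S ⊆ U
homogeneous⊆ homF G (T , T⊆U , _ , f , inj , f∈T , Ff) with homF (induced G f) Ff ⊤ (∣⊤∣≡n _)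
... | S , _ , ∣S∣≡k , hom =
  image f S , (trans (∣image∣ inj S) ∣S∣≡k , image-homogeneous G f hom) , image-⊆ (T⊆U ∘ f∈T) S

⊆⇒ExtendsBy : ∀ {n} {S U : Subset n} {k m} → S ⊆ U → ∣ S ∣ ≡ k → ∣ U ∣ ≡ m → ExtendsBy S (m ∸ k) U
⊆⇒ExtendsBy S⊆U refl refl = S⊆U , sym (m+[n∸m]≡n (p⊆q⇒∣p∣≤∣q∣ S⊆U))

lemma2p2 : ∀ {ℓ} (F : Family ℓ) (t k n : ℕ) →
    Hereditary F →
    (∀ {m} (H : Graph m) → F H → HomProp t k H) →
    1 ≤ t → 2 * t ≤ n →
    (G : Graph n) →
    -- at least half of the (2t)-subsets U of V(G) contain t vertices inducing a graph in F
    (∃[ L ] (Unique L × All (λ U → ∣ U ∣ ≡ 2 * t × ContainsInF F t G U) L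
             × n C (2 * t) ≤ 2 * length L)) →
    -- G has at least (1/2)(n/(2t))^k homogeneous sets of order k
    ∃[ L ] (Unique L × All (λ (S : Subset n) → ∣ S ∣ ≡ k × Homogeneous G S) L
            × n ^ k ≤ 2 * ((2 * t) ^ k) * length L)
lemma2p2 F t k n _ homF _ 2t≤n G (Us , uniqUs , goodUs , half) =
  let Ss , uniqSs , homSs , covered = unique-witnesses (Vec.≡-dec Bool._≟_) (All.map witness goodUs)
  in Ss , uniqSs , homSs , n^k≤2*m^k*h (k≤2t goodUs half) 2t≤n half
       (length-≤-cover (λ S → ExtendsBy? S j) _ Ss (All.map (extensions≤ ∘ proj₁) homSs) uniqUs covered)
  where
  j = 2 * t ∸ k

  witness : ∀ {U} → ∣ U ∣ ≡ 2 * t × ContainsInF F t G U → ∃ λ S → (∣ S ∣ ≡ k × Homogeneous G S) × ExtendsBy S j U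
  witness (∣U∣≡2t , good) with homogeneous⊆ homF G good
  ... | S , (∣S∣≡k , hom) , S⊆U = S , (∣S∣≡k , hom) , ⊆⇒ExtendsBy S⊆U ∣S∣≡k ∣U∣≡2t

  k≤2t : ∀ {Vs} → All (λ U → ∣ U ∣ ≡ 2 * t × ContainsInF F t G U) Vs → n C (2 * t) ≤ 2 * length Vs → k ≤ 2 * t
  k≤2t []                    nC2t≤0 = contradiction (≤-trans (k≤n⇒nCk>0 2t≤n) nC2t≤0) λ ()
  k≤2t ((∣U∣≡2t , good) ∷ _) _ with homogeneous⊆ homF G good
  ... | _ , (∣S∣≡k , _) , S⊆U = subst₂ _≤_ ∣S∣≡k ∣U∣≡2t (p⊆q⇒∣p∣≤∣q∣ S⊆U)

  extensions≤ : ∀ {S} → ∣ S ∣ ≡ k → ∀ {Vs} → Unique Vs → All (ExtendsBy S j) Vs → length Vs ≤ (n ∸ k) C j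
  extensions≤ {S} ∣S∣≡k uniq ext =
    subst (λ z → _ ≤ z C j) (trans (∣∁p∣≡n∸∣p∣ S) (cong (n ∸_) ∣S∣≡k)) (length-extensions≤ S j uniq ext)
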